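{- For every graph $G$ on $n$ vertices, $\mathrm{fix}(G)\leq\left\lfloor n\cdot\frac{\chi(G)-1}{\chi(G)}\right\rfloor$.
   Context: An $r$-coloring of $G$ is any map $V(G)\to\{1,\dots,r\}$; it is proper if adjacent vertices receive different colors; $\chi(G)$ is the chromatic number. For an $r$-coloring $\varphi$, $\mathrm{fix}^{\varphi}_r(G)$ is the minimum, over all proper $r$-colorings $\varphi'$ of $G$, of the number of vertices on which $\varphi$ and $\varphi'$ differ. The $r$-fixing number is $\mathrm{fix}_r(G)=\max_{\varphi}\mathrm{fix}^{\varphi}_r(G)$ over all $r$-colorings $\varphi$, and the fixing number is $\mathrm{fix}(G)=\max_{r\geq\chi(G)}\mathrm{fix}_r(G)$. -}

module Defs where

open import Data.Nat using (ℕ; zero; suc; _*_; _∸_; _≤_; _<_)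
open import Data.Nat.DivMod using (_/_)
open import Data.Fin using (Fin)
open import Data.Fin.Properties using (_≟_)
open import Data.List using (List; length; filter; allFin)
open import Data.Product using (Σ; _×_)
open import Relation.Nullary using (¬_; Dec; ¬?)
open import Relation.Binary.PropositionalEquality using (_≡_)

record Graph (n : ℕ) : Set₁ where
  field
    Adj   : Fin n → Fin n → Set
    sym   : ∀ {u v} → Adj u v → Adj v u
    irrefl : ∀ {v} → ¬ Adj v v

open Graph public

Coloring : ℕ → ℕ → Set
Coloring n r = Fin n → Fin r

Proper : ∀ {n r} → Graph n → Coloring n r → Set
Proper G φ = ∀ u v → Adj G u v → ¬ (φ u ≡ φ v)

IsChromaticNumber : ∀ {n} → Graph n → ℕ → Set
IsChromaticNumber {n} G k =
  Σ (Coloring n k) (Proper G) × (∀ j → j < k → ¬ Σ (Coloring n j) (Proper G))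

dist : ∀ {n r} → Coloring n r → Coloring n r → ℕ
dist {n} φ ψ = length (filter (λ v → ¬? (φ v ≟ ψ v)) (allFin n))

-- fix^φ_r(G) ≤ b  (the minimum over proper φ' of dist φ φ' is ≤ b)
FixColLe : ∀ {n r} → Graph n → Coloring n r → ℕ → Set
FixColLe {n} {r} G φ b = Σ (Coloring n r) (λ φ' → Proper G φ' × dist φ φ' ≤ b)

-- fix(G) ≤ b, where χ is the chromatic number of G:
-- for all r ≥ χ(G) and all r-colorings φ, fix^φ_r(G) ≤ b.
FixLe : ∀ {n} → Graph n → ℕ → ℕ → Set
FixLe {n} G χ b = ∀ r → χ ≤ r → (φ : Coloring n r) → FixColLe G φ b

-- ⌊ n (k-1) / k ⌋, with the (only relevant for n = 0) convention value 0 for k = 0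
floorBound : ℕ → ℕ → ℕ
floorBound n zero = zero
floorBound n (suc k) = (n * k) / suc k

-- Fix a proper coloring c with N = χ(G) colors and an arbitrary r-coloring φ, and clamp the
-- colors of φ into {0, …, N-1}.  For each shift i < N the coloring v ↦ c v + i (mod N) is
-- proper; lift it to an r-coloring ψᵢ that keeps φ v wherever the clamp of φ v already equals
-- c v + i, and uses c v + i otherwise.  Clamping ψᵢ gives back the shifted c, so ψᵢ is proper.
-- Every vertex is kept by exactly one shift, so some ψᵢ keeps at least n / N vertices and
-- changes at most n (N-1) / N of them.
module Submission where

open import Defs
open import Data.Empty using (⊥-elim)
open import Data.Fin using (Fin; toℕ; fromℕ<)
open import Data.Fin.Properties using (toℕ-injective; toℕ-fromℕ<; toℕ<n)
import Data.Fin.Properties as Fin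
open import Data.List using (List; []; _∷_; length; filter; allFin)
open import Data.List.Properties using (length-tabulate; filter-≐; filter-all; filter-none)
open import Data.List.Relation.Unary.All using (universal)
open import Data.Nat using (ℕ; zero; suc; _+_; _*_; _∸_; _⊓_; _≤_; _<_; z≤n; s≤s; s≤s⁻¹;
  _≟_; _≤?_; _<?_; NonZero)
open import Data.Nat.DivMod using (_%_; _/_; %-distribˡ-+; m%n%n≡m%n; m<n⇒m%n≡m; m%n<n;
  [m+n]%n≡m%n; m*n/n≡m; /-monoˡ-≤)
open import Data.Nat.Properties
open import Data.Product using (Σ; ∃; _×_; _,_; proj₁; proj₂)
open import Data.Sum using (_⊎_; inj₁; inj₂)
open import Level using (Level)
open import Relation.Nullary using (yes; no; ¬?; contradiction)
open import Relation.Unary using (Pred; Decidable; _⊆_; _≐_; _⊥_)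
open import Relation.Unary.Properties using (_∪?_; ∁?)
open import Relation.Binary.PropositionalEquality as ≡ using (_≡_; _≢_; refl; cong)

private variable
  a p q : Level
  A : Set a

count : {P : Pred A p} → Decidable P → List A → ℕ
count P? xs = length (filter P? xs)

module _ {P : Pred A p} (P? : Decidable P) where

  count-complement : ∀ xs → count P? xs + count (∁? P?) xs ≡ length xs
  count-complement [] = refl
  count-complement (x ∷ xs) with P? x
  ... | yes _ = cong suc (count-complement xs)
  ... | no  _ = ≡.trans (+-suc _ _) (cong suc (count-complement xs))

  count-∁ : ∀ xs → count (∁? P?) xs ≡ length xs ∸ count P? xs
  count-∁ xs = ≡.trans (≡.sym (m+n∸m≡n (count P? xs) _)) (cong (_∸ count P? xs) (count-complement xs))

module _ {P : Pred A p} {Q : Pred A q} (P? : Decidable P) (Q? : Decidable Q) where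

  count-mono : P ⊆ Q → ∀ xs → count P? xs ≤ count Q? xs
  count-mono P⊆Q [] = z≤n
  count-mono P⊆Q (x ∷ xs) with P? x | Q? x
  ... | yes _  | yes _  = s≤s (count-mono P⊆Q xs)
  ... | yes px | no ¬qx = contradiction (P⊆Q px) ¬qx
  ... | no  _  | yes _  = m≤n⇒m≤1+n (count-mono P⊆Q xs)
  ... | no  _  | no  _  = count-mono P⊆Q xs

  count-≐ : P ≐ Q → ∀ xs → count P? xs ≡ count Q? xs
  count-≐ P≐Q xs = cong length (filter-≐ P? Q? P≐Q xs)

  count-∪ : P ⊥ Q → ∀ xs → count (P? ∪? Q?) xs ≡ count P? xs + count Q? xs
  count-∪ P⊥Q [] = refl
  count-∪ P⊥Q (x ∷ xs) with P? x | Q? x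
  ... | yes px | yes qx = ⊥-elim (P⊥Q (px , qx))
  ... | yes _  | no  _  = cong suc (count-∪ P⊥Q xs)
  ... | no  _  | yes _  = ≡.trans (cong suc (count-∪ P⊥Q xs)) (≡.sym (+-suc _ _))
  ... | no  _  | no  _  = count-∪ P⊥Q xs

sumBelow : (ℕ → ℕ) → ℕ → ℕ
sumBelow f zero    = 0
sumBelow f (suc m) = sumBelow f m + f m

sumBelow-count-fibres : (d : A → ℕ) (xs : List A) → ∀ m →
  sumBelow (λ j → count (λ x → d x ≟ j) xs) m ≡ count (λ x → d x <? m) xs
sumBelow-count-fibres d xs zero =
  ≡.sym (cong length (filter-none (λ x → d x <? 0) (universal (λ _ ()) xs)))
sumBelow-count-fibres d xs (suc m) = begin
  sumBelow fibre m + fibre m    ≡⟨ cong (_+ fibre m) (sumBelow-count-fibres d xs m) ⟩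
  count below xs + fibre m      ≡⟨ count-∪ below at (λ (d<m , d≡m) → <⇒≢ d<m d≡m) xs ⟨
  count (below ∪? at) xs        ≡⟨ count-≐ (below ∪? at) (λ x → d x <? suc m) split xs ⟩
  count (λ x → d x <? suc m) xs ∎
  where
  open ≡.≡-Reasoning
  fibre = λ j → count (λ x → d x ≟ j) xs
  below = λ x → d x <? m
  at    = λ x → d x ≟ m
  split : (λ x → d x < m ⊎ d x ≡ m) ≐ (λ x → d x < suc m)
  split = (λ { (inj₁ d<m) → m<n⇒m<1+n d<m ; (inj₂ refl) → ≤-refl }) , m<1+n⇒m<n∨m≡n

sumBelow-≤-* : ∀ {f c} m → (∀ i → i < m → f i ≤ c) → sumBelow f m ≤ m * c
sumBelow-≤-* zero    _     = z≤n
sumBelow-≤-* {f} {c} (suc m) f≤c = begin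
  sumBelow f m + f m ≤⟨ +-mono-≤ (sumBelow-≤-* m (λ i i<m → f≤c i (m<n⇒m<1+n i<m))) (f≤c m ≤-refl) ⟩
  m * c + c          ≡⟨ +-comm (m * c) c ⟩
  suc m * c          ∎
  where open ≤-Reasoning

<-suc-bounded : ∀ {f : ℕ → ℕ} {m c} → (∀ i → i < m → f i ≤ c) → f m ≤ c → ∀ i → i < suc m → f i ≤ c
<-suc-bounded f<m≤c fm≤c i i<1+m with m<1+n⇒m<n∨m≡n i<1+m
... | inj₁ i<m  = f<m≤c i i<m
... | inj₂ refl = fm≤c

argmax : (f : ℕ → ℕ) (k : ℕ) → ∃ λ j → j < suc k × (∀ i → i < suc k → f i ≤ f j)
argmax f zero = 0 , s≤s z≤n , λ { zero _ → ≤-refl ; (suc _) (s≤s ()) }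
argmax f (suc k) with argmax f k
... | j , j<1+k , f≤fj with f (suc k) ≤? f j
...   | yes fk≤fj = j , m<n⇒m<1+n j<1+k , <-suc-bounded f≤fj fk≤fj
...   | no  fk≰fj = suc k , ≤-refl ,
  <-suc-bounded (λ i i<1+k → ≤-trans (f≤fj i i<1+k) (<⇒≤ (≰⇒> fk≰fj))) ≤-refl

average-≤-max : (f : ℕ → ℕ) (k : ℕ) → ∃ λ j → j < suc k × sumBelow f (suc k) ≤ suc k * f j
average-≤-max f k with argmax f k
... | j , j<1+k , f≤fj = j , j<1+k , sumBelow-≤-* (suc k) f≤fj

∸-≤-floorBound : ∀ {n k x} → n ≤ suc k * x → n ∸ x ≤ floorBound n (suc k)
∸-≤-floorBound {n} {k} {x} n≤Nx = begin
  n ∸ x                   ≡⟨ m*n/n≡m (n ∸ x) (suc k) ⟨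
  (n ∸ x) * suc k / suc k ≤⟨ /-monoˡ-≤ (suc k) scaled ⟩
  n * k / suc k           ∎
  where
  open ≤-Reasoning
  scaled : (n ∸ x) * suc k ≤ n * k
  scaled = begin
    (n ∸ x) * suc k       ≡⟨ *-distribʳ-∸ (suc k) n x ⟩
    n * suc k ∸ x * suc k ≤⟨ ∸-monoʳ-≤ (n * suc k) (≤-trans n≤Nx (≤-reflexive (*-comm (suc k) x))) ⟩
    n * suc k ∸ n         ≡⟨ cong (_∸ n) (*-suc n k) ⟩
    n + n * k ∸ n         ≡⟨ m+n∸m≡n n (n * k) ⟩
    n * k                 ∎

[m%n+o]%n≡[m+o]%n : ∀ m o n .{{_ : NonZero n}} → (m % n + o) % n ≡ (m + o) % n
[m%n+o]%n≡[m+o]%n m o n = begin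
  (m % n + o) % n         ≡⟨ %-distribˡ-+ (m % n) o n ⟩
  (m % n % n + o % n) % n ≡⟨ cong (λ z → (z + o % n) % n) (m%n%n≡m%n m n) ⟩
  (m % n + o % n) % n     ≡⟨ %-distribˡ-+ m o n ⟨
  (m + o) % n             ∎
  where open ≡.≡-Reasoning

[[m+o]%n+p]%n≡m : ∀ {m o p n} .{{_ : NonZero n}} → o + p ≡ n → m < n → ((m + o) % n + p) % n ≡ m
[[m+o]%n+p]%n≡m {m} {o} {p} {n} o+p≡n m<n = begin
  ((m + o) % n + p) % n ≡⟨ [m%n+o]%n≡[m+o]%n (m + o) p n ⟩
  (m + o + p) % n       ≡⟨ cong (_% n) (≡.trans (+-assoc m o p) (cong (m +_) o+p≡n)) ⟩
  (m + n) % n           ≡⟨ [m+n]%n≡m%n m n ⟩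
  m % n                 ≡⟨ m<n⇒m%n≡m m<n ⟩
  m                     ∎
  where open ≡.≡-Reasoning

ProperLabelling : ∀ {n} → Graph n → (Fin n → ℕ) → Set
ProperLabelling G t = ∀ u v → Adj G u v → t u ≢ t v

module Recolor {n r} (φ : Coloring n r) (p : Fin r → ℕ) (t : Fin n → ℕ)
               (preimage : ∀ v → Σ (Fin r) λ a → p a ≡ t v) where

  recolor : Coloring n r
  recolor v with p (φ v) ≟ t v
  ... | yes _ = φ v
  ... | no  _ = proj₁ (preimage v)

  p∘recolor≡t : ∀ v → p (recolor v) ≡ t v
  p∘recolor≡t v with p (φ v) ≟ t v
  ... | yes p∘φ≡t = p∘φ≡t
  ... | no  _     = proj₂ (preimage v)

  recolor-proper : (G : Graph n) → ProperLabelling G t → Proper G recolor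
  recolor-proper G t-proper u v uv ψu≡ψv =
    t-proper u v uv (≡.trans (≡.sym (p∘recolor≡t u)) (≡.trans (cong p ψu≡ψv) (p∘recolor≡t v)))

  recolor-keeps : ∀ v → p (φ v) ≡ t v → φ v ≡ recolor v
  recolor-keeps v p∘φ≡t with p (φ v) ≟ t v
  ... | yes _      = refl
  ... | no  p∘φ≢t = contradiction p∘φ≡t p∘φ≢t

  dist-recolor : dist φ recolor ≤ count (λ v → ¬? (p (φ v) ≟ t v)) (allFin n)
  dist-recolor = count-mono (λ v → ¬? (φ v Fin.≟ recolor v)) (λ v → ¬? (p (φ v) ≟ t v))
    (λ {v} φ≢ψ p∘φ≡t → φ≢ψ (recolor-keeps v p∘φ≡t)) (allFin n)

module _ {n k r} (G : Graph n) {c : Coloring n (suc k)} (c-proper : Proper G c)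
         (1+k≤r : suc k ≤ r) (φ : Coloring n r) where

  private
    N = suc k

    clamp : Fin r → ℕ
    clamp a = toℕ a ⊓ k

    shifted : ℕ → Fin n → ℕ
    shifted i v = (i + toℕ (c v)) % N

    -- the shift i < N for which clamp (φ v) ≡ shifted i v
    keeping-shift : Fin n → ℕ
    keeping-shift v = (clamp (φ v) + (N ∸ toℕ (c v))) % N

    kept : ℕ → ℕ
    kept i = count (λ v → keeping-shift v ≟ i) (allFin n)

    clamp-preimage : ∀ i v → Σ (Fin r) λ a → clamp a ≡ shifted i v
    clamp-preimage i v = fromℕ< (<-≤-trans shifted<N 1+k≤r) ,
      ≡.trans (cong (_⊓ k) (toℕ-fromℕ< _)) (m≤n⇒m⊓n≡m (s≤s⁻¹ shifted<N))
      where
      shifted<N : shifted i v < N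
      shifted<N = m%n<n (i + toℕ (c v)) N

    shifted-proper : ∀ i → i < N → ProperLabelling G (shifted i)
    shifted-proper i i<N u v uv eq = c-proper u v uv (toℕ-injective (begin
      toℕ (c u)                           ≡⟨ unshift u ⟨
      ((toℕ (c u) + i) % N + (N ∸ i)) % N ≡⟨ cong (λ z → (z % N + (N ∸ i)) % N) (+-comm (toℕ (c u)) i) ⟩
      (shifted i u + (N ∸ i)) % N         ≡⟨ cong (λ z → (z + (N ∸ i)) % N) eq ⟩
      (shifted i v + (N ∸ i)) % N         ≡⟨ cong (λ z → (z % N + (N ∸ i)) % N) (+-comm i (toℕ (c v))) ⟩
      ((toℕ (c v) + i) % N + (N ∸ i)) % N ≡⟨ unshift v ⟩
      toℕ (c v)                           ∎))
      where
      open ≡.≡-Reasoning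
      unshift : ∀ w → ((toℕ (c w) + i) % N + (N ∸ i)) % N ≡ toℕ (c w)
      unshift w = [[m+o]%n+p]%n≡m (m+[n∸m]≡n (<⇒≤ i<N)) (toℕ<n (c w))

    keeping-shift-correct : ∀ i v → keeping-shift v ≡ i → clamp (φ v) ≡ shifted i v
    keeping-shift-correct i v refl =
      ≡.sym ([[m+o]%n+p]%n≡m (m∸n+n≡m (<⇒≤ (toℕ<n (c v)))) (s≤s (m⊓n≤n (toℕ (φ v)) k)))

    open module Shift i = Recolor φ clamp (shifted i) (clamp-preimage i)

    dist-recolor-≤ : ∀ i → dist φ (recolor i) ≤ n ∸ kept i
    dist-recolor-≤ i = begin
      dist φ (recolor i)                                       ≤⟨ dist-recolor i ⟩
      count (λ v → ¬? (clamp (φ v) ≟ shifted i v)) (allFin n) ≤⟨ count-mono _ _ disagree⇒unkept (allFin n) ⟩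
      count (λ v → ¬? (keeping-shift v ≟ i)) (allFin n)       ≡⟨ count-∁ (λ v → keeping-shift v ≟ i) (allFin n) ⟩
      length (allFin n) ∸ kept i                               ≡⟨ cong (_∸ kept i) (length-tabulate (λ v → v)) ⟩
      n ∸ kept i                                               ∎
      where
      open ≤-Reasoning
      disagree⇒unkept : ∀ {v} → clamp (φ v) ≢ shifted i v → keeping-shift v ≢ i
      disagree⇒unkept clamp≢ ks≡i = clamp≢ (keeping-shift-correct i _ ks≡i)

    sumBelow-kept : sumBelow kept N ≡ n
    sumBelow-kept = begin
      sumBelow kept N                               ≡⟨ sumBelow-count-fibres keeping-shift (allFin n) N ⟩
      count (λ v → keeping-shift v <? N) (allFin n) ≡⟨ cong length (filter-all _ (universal keeping-shift<N (allFin n))) ⟩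
      length (allFin n)                             ≡⟨ length-tabulate (λ v → v) ⟩
      n                                             ∎
      where
      open ≡.≡-Reasoning
      keeping-shift<N : ∀ v → keeping-shift v < N
      keeping-shift<N v = m%n<n (clamp (φ v) + (N ∸ toℕ (c v))) N

  Proper⇒FixColLe : FixColLe G φ (floorBound n N)
  Proper⇒FixColLe with average-≤-max kept k
  ... | i , i<N , sum≤Nkept =
    recolor i , recolor-proper i G (shifted-proper i i<N) ,
    ≤-trans (dist-recolor-≤ i) (∸-≤-floorBound (≡.subst (_≤ N * kept i) sumBelow-kept sum≤Nkept))

theorem31 : ∀ (n : ℕ) (G : Graph n) (χ : ℕ) → IsChromaticNumber G χ →
    FixLe G χ (floorBound n χ)
theorem31 zero    G χ       _                     r _     φ = φ , (λ ()) , z≤n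
theorem31 (suc n) G zero    ((c , _) , _)         r _     φ with c Data.Fin.zero
... | ()
theorem31 (suc n) G (suc k) ((_ , c-proper) , _) r 1+k≤r φ = Proper⇒FixColLe G c-proper 1+k≤r φ
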